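{- Let $n\ge 4$ and $\tau\in\mathfrak{S}_n$. The following are equivalent: (i) $\tau\in D_n$; (ii) for every subset $I=\{i_1<i_2<i_3<i_4\}\subset\{1,\dots,n\}$, the standardization of $(\tau(i_1),\tau(i_2),\tau(i_3),\tau(i_4))$ belongs to $D_4$.
   Context: $D_n\subset\mathfrak{S}_n$ is the dihedral group generated by the cyclic shift $c=(1\,2\,\cdots\,n)$ and the reversal $\sigma_0(i)=n+1-i$; its elements are $c^k$ and $c^k\circ\sigma_0$. The standardization of a sequence of four distinct integers is the permutation in $\mathfrak{S}_4$ obtained by replacing each entry by its rank among the four entries. -}

module Defs where

open import Data.Nat using (ℕ; zero; suc)
open import Data.Nat.DivMod using (_mod_)
open import Data.Fin using (Fin; toℕ; opposite; _<_; _<?_)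
open import Data.Fin.Permutation using (Permutation′; _⟨$⟩ʳ_)
open import Data.List using (length; filter; allFin)
open import Data.Vec using (lookup; _∷_; [])
open import Data.Sum using (_⊎_)
open import Data.Product using (∃-syntax; _×_)
open import Relation.Binary.PropositionalEquality using (_≡_)
open import Function using (id; _∘_)

-- Positions/values are 0-indexed: Fin n = {0,…,n-1} stands for {1,…,n}.

cyc : ∀ {n} → Fin n → Fin n
cyc {suc m} i = suc (toℕ i) mod suc m

rev : ∀ {n} → Fin n → Fin n
rev = opposite

_^_ : ∀ {A : Set} → (A → A) → ℕ → A → A
(f ^ zero) = id
(f ^ suc k) = f ∘ (f ^ k)

InDihedral : ∀ n → (Fin n → Fin n) → Set
InDihedral n τ =
  ∃[ k ] ((∀ i → τ i ≡ (cyc ^ k) i) ⊎ (∀ i → τ i ≡ ((cyc ^ k) ∘ rev) i))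

rank : ∀ {n} → (Fin 4 → Fin n) → Fin 4 → ℕ
rank f j = length (filter (λ l → f l <? f j) (allFin 4))

-- "the standardization of f belongs to D₄": the permutation of Fin 4
-- whose values are the ranks of the entries of f lies in D₄
StdInD4 : ∀ {n} → (Fin 4 → Fin n) → Set
StdInD4 f = ∃[ d ] (InDihedral 4 d × (∀ j → toℕ (d j) ≡ rank f j))

pattern4 : ∀ {n} → Permutation′ n → (i₁ i₂ i₃ i₄ : Fin n) → Fin 4 → Fin n
pattern4 τ i₁ i₂ i₃ i₄ j = τ ⟨$⟩ʳ lookup (i₁ ∷ i₂ ∷ i₃ ∷ i₄ ∷ []) j

module Submission where

-- Call a, b, c, d circular if they lie in this order around ℤ/n, in one of the two directions.
-- Rotations and reflections of the values preserve circularity, and the identity sends increasing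
-- quadruples of positions to circular ones; hence so does every τ ∈ D_n. Conversely, suppose τ
-- sends every increasing quadruple to a circular one. After a reflection and a rotation of the
-- values we may assume τ(0) = 0 with τ(0), τ(1), τ(2) positively oriented; circularity of
-- (0, j+1, j+2, j+3) then forces τ(1) < τ(2) < ⋯ < τ(n-1), so τ is the identity. For n = 4 this
-- says that a permutation of {0,1,2,3} lies in D₄ iff its values are circular; as standardization
-- preserves the order of the entries, (ii) is therefore the condition above.

open import Defs
open import Data.Nat using (ℕ; suc; _≤_)
open import Data.Fin using (Fin)
open import Data.Fin.Permutation using (Permutation′; _⟨$⟩ʳ_)
open import Function.Bundles using (_⇔_; mk⇔)

-- Scoped so that _<_ is the order on ℕ here; the statement of lemma5p3 uses the one on Fin.
module _ where
  open import Data.Nat using (zero; _+_; _∸_; _<_; z≤n; s≤s; s≤s⁻¹; _%_)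
  open import Data.Nat.Properties
    using ( ≤-refl; ≤-reflexive; ≤-trans; ≤-antisym; <-irrefl; <-asym; <-trans; <-≤-trans; <-cmp
          ; <⇒≤; n<1+n; m≤n⇒m≤1+n; m≤n+m; m≤n⇒m<n∨m≡n; +-comm; +-suc; +-identityʳ
          ; m∸n≤m; m∸n+n≡m; m+[n∸m]≡n; +-∸-assoc; n∸n≡0; ∸-monoʳ-< )
  open import Data.Nat.DivMod using (_mod_; n%n≡0; m<n⇒m%n≡m; [m+n]%n≡m%n; %-distribˡ-+; m%n%n≡m%n)
  open import Data.Fin as Fin using (toℕ; fromℕ<; _<?_)
  open import Data.Fin.Properties
    using (toℕ-injective; toℕ<n; toℕ-fromℕ<; opposite-prop; opposite-involutive)
  open import Data.List using ([]; _∷_; length; filter; allFin)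
  open import Data.List.Properties using (filter-notAll)
  open import Data.List.Relation.Unary.Any as Any using (Any; here; there)
  open import Data.List.Membership.Propositional.Properties using (∈-allFin)
  open import Data.Product using (_×_; _,_; proj₁; proj₂; ∃-syntax)
  open import Data.Sum using (_⊎_; inj₁; inj₂)
  open import Function using (id; _∘_)
  open import Relation.Binary using (tri<; tri≈; tri>)
  open import Relation.Binary.PropositionalEquality
  open import Relation.Nullary using (¬_; yes; no; contradiction)
  open import Relation.Unary using (Pred; Decidable; _⊆_)

  Cyclic : ℕ → ℕ → ℕ → Set
  Cyclic a b c = (a < b × b < c) ⊎ (b < c × c < a) ⊎ (c < a × a < b)

  Circular : ℕ → ℕ → ℕ → ℕ → Set
  Circular a b c d = (Cyclic a b c × Cyclic a c d) ⊎ (Cyclic a c b × Cyclic a d c)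

  cyclic-rotate : ∀ {a b c} → Cyclic a b c → Cyclic b c a
  cyclic-rotate (inj₁ p)        = inj₂ (inj₂ p)
  cyclic-rotate (inj₂ (inj₁ p)) = inj₁ p
  cyclic-rotate (inj₂ (inj₂ p)) = inj₂ (inj₁ p)

  circular-orientation : ∀ {a b c d} → Circular a b c d → Cyclic a b c ⊎ Cyclic a c b
  circular-orientation (inj₁ (p , _)) = inj₁ p
  circular-orientation (inj₂ (p , _)) = inj₂ p

  cyclic-from-0 : ∀ {x y} → Cyclic 0 x y → 0 < x × x < y
  cyclic-from-0 (inj₁ p)               = p
  cyclic-from-0 (inj₂ (inj₁ (_ , ())))
  cyclic-from-0 (inj₂ (inj₂ (() , _)))

  circular-from-0 : ∀ {x y z} → Circular 0 x y z → x < y → y < z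
  circular-from-0 (inj₁ (_ , q)) x<y = proj₂ (cyclic-from-0 q)
  circular-from-0 (inj₂ (p , _)) x<y = contradiction x<y (<-asym (proj₂ (cyclic-from-0 p)))

  module _ {I : Set} {u v : I → ℕ} where

    cyclic-map : (∀ {x y} → u x < u y → v x < v y) →
                 ∀ {a b c} → Cyclic (u a) (u b) (u c) → Cyclic (v a) (v b) (v c)
    cyclic-map f (inj₁ (p , q))        = inj₁ (f p , f q)
    cyclic-map f (inj₂ (inj₁ (p , q))) = inj₂ (inj₁ (f p , f q))
    cyclic-map f (inj₂ (inj₂ (p , q))) = inj₂ (inj₂ (f p , f q))

    cyclic-map-anti : (∀ {x y} → u x < u y → v y < v x) →
                      ∀ {a b c} → Cyclic (u a) (u b) (u c) → Cyclic (v a) (v c) (v b)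
    cyclic-map-anti f (inj₁ (p , q))        = inj₂ (inj₁ (f q , f p))
    cyclic-map-anti f (inj₂ (inj₁ (p , q))) = inj₁ (f q , f p)
    cyclic-map-anti f (inj₂ (inj₂ (p , q))) = inj₂ (inj₂ (f q , f p))

    circular-map : (∀ {x y} → u x < u y → v x < v y) → ∀ {a b c d} →
                   Circular (u a) (u b) (u c) (u d) → Circular (v a) (v b) (v c) (v d)
    circular-map f (inj₁ (p , q)) = inj₁ (cyclic-map f p , cyclic-map f q)
    circular-map f (inj₂ (p , q)) = inj₂ (cyclic-map f p , cyclic-map f q)

    circular-map-anti : (∀ {x y} → u x < u y → v y < v x) → ∀ {a b c d} →
                        Circular (u a) (u b) (u c) (u d) → Circular (v a) (v b) (v c) (v d)
    circular-map-anti f (inj₁ (p , q)) = inj₂ (cyclic-map-anti f p , cyclic-map-anti f q)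
    circular-map-anti f (inj₂ (p , q)) = inj₁ (cyclic-map-anti f p , cyclic-map-anti f q)

  module _ {a p q} {A : Set a} {P : Pred A p} {Q : Pred A q}
           (P? : Decidable P) (Q? : Decidable Q) (P⊆Q : P ⊆ Q) where

    length-filter-mono : ∀ xs → length (filter P? xs) ≤ length (filter Q? xs)
    length-filter-mono []       = z≤n
    length-filter-mono (x ∷ xs) with P? x | Q? x
    ... | yes _  | yes _  = s≤s (length-filter-mono xs)
    ... | yes px | no ¬qx = contradiction (P⊆Q px) ¬qx
    ... | no _   | yes _  = m≤n⇒m≤1+n (length-filter-mono xs)
    ... | no _   | no _   = length-filter-mono xs

    length-filter-< : ∀ {xs} → Any (λ x → Q x × ¬ P x) xs →
                      length (filter P? xs) < length (filter Q? xs)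
    length-filter-< {x ∷ xs} (here (qx , ¬px)) with P? x | Q? x
    ... | yes px | _      = contradiction px ¬px
    ... | no _   | yes _  = s≤s (length-filter-mono xs)
    ... | no _   | no ¬qx = contradiction qx ¬qx
    length-filter-< {x ∷ xs} (there any) with P? x | Q? x
    ... | yes _  | yes _  = s≤s (length-filter-< any)
    ... | yes px | no ¬qx = contradiction (P⊆Q px) ¬qx
    ... | no _   | yes _  = m≤n⇒m≤1+n (length-filter-< any)
    ... | no _   | no _   = length-filter-< any

  module _ {n : ℕ} (g : ℕ → ℕ) (g-inc : ∀ i → suc i < n → g i < g (suc i))
           (g-bound : ∀ i → i < n → g i < n) where

    private
      below : ∀ i → i < n → i ≤ g i
      below zero    _     = z≤n
      below (suc i) i+1<n = ≤-trans (s≤s (below i (<-trans (n<1+n i) i+1<n))) (g-inc i i+1<n)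

      above : ∀ d i → d + suc i ≡ n → g i ≤ i
      above zero    i refl = s≤s⁻¹ (g-bound i (n<1+n i))
      above (suc d) i eq   = s≤s⁻¹ (<-≤-trans (g-inc i i+1<n) (above d (suc i) eq′))
        where
        eq′ : d + suc (suc i) ≡ n
        eq′ = trans (+-suc d (suc i)) eq
        i+1<n : suc i < n
        i+1<n = ≤-trans (m≤n+m (suc (suc i)) d) (≤-reflexive eq′)

    strictlyIncreasing⇒id : ∀ i → i < n → g i ≡ i
    strictlyIncreasing⇒id i i<n = ≤-antisym (above (n ∸ suc i) i (m∸n+n≡m i<n)) (below i i<n)

  circularFan⇒increasing : ∀ {n} (g : ℕ → ℕ) → g 0 ≡ 0 → Cyclic (g 0) (g 1) (g 2) →
    (∀ j → 3 + j < n → Circular (g 0) (g (1 + j)) (g (2 + j)) (g (3 + j))) →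
    ∀ i → suc i < n → g i < g (suc i)
  circularFan⇒increasing {n} g g0≡0 base fan = increasing
    where
    base₀ : Cyclic 0 (g 1) (g 2)
    base₀ = subst (λ a → Cyclic a (g 1) (g 2)) g0≡0 base

    fan₀ : ∀ j → 3 + j < n → Circular 0 (g (1 + j)) (g (2 + j)) (g (3 + j))
    fan₀ j h = subst (λ a → Circular a (g (1 + j)) (g (2 + j)) (g (3 + j))) g0≡0 (fan j h)

    increasing⁺ : ∀ j → 2 + j < n → g (1 + j) < g (2 + j)
    increasing⁺ zero    _ = proj₂ (cyclic-from-0 base₀)
    increasing⁺ (suc j) h = circular-from-0 (fan₀ j h) (increasing⁺ j (<-trans (n<1+n _) h))

    increasing : ∀ i → suc i < n → g i < g (suc i)
    increasing zero    _ = subst (_< g 1) (sym g0≡0) (proj₁ (cyclic-from-0 base₀))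
    increasing (suc i) h = increasing⁺ i h

  ^-+ : ∀ {A : Set} (f : A → A) j k x → (f ^ (j + k)) x ≡ (f ^ j) ((f ^ k) x)
  ^-+ f zero    k x = refl
  ^-+ f (suc j) k x = cong f (^-+ f j k x)

  rev-anti : ∀ {n} {x y : Fin n} → toℕ x < toℕ y → toℕ (rev y) < toℕ (rev x)
  rev-anti {x = x} {y} x<y rewrite opposite-prop x | opposite-prop y = ∸-monoʳ-< (s≤s x<y) (toℕ<n y)

  module _ {m : ℕ} where

    private
      n : ℕ
      n = suc m

    toℕ-cyc : (x : Fin n) → toℕ (cyc x) ≡ suc (toℕ x) % n
    toℕ-cyc x = toℕ-fromℕ< _

    toℕ-cyc-< : {x : Fin n} → toℕ x < m → toℕ (cyc x) ≡ suc (toℕ x)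
    toℕ-cyc-< {x} x<m = trans (toℕ-cyc x) (m<n⇒m%n≡m (s≤s x<m))

    toℕ-cyc-last : {x : Fin n} → toℕ x ≡ m → toℕ (cyc x) ≡ 0
    toℕ-cyc-last {x} x≡m = trans (toℕ-cyc x) (trans (cong (λ y → suc y % n) x≡m) (n%n≡0 n))

    toℕ-cyc^ : ∀ k (x : Fin n) → toℕ ((cyc ^ k) x) ≡ (toℕ x + k) % n
    toℕ-cyc^ zero    x = sym (trans (cong (_% n) (+-identityʳ (toℕ x))) (m<n⇒m%n≡m (toℕ<n x)))
    toℕ-cyc^ (suc k) x = begin
      toℕ (cyc ((cyc ^ k) x))           ≡⟨ toℕ-cyc _ ⟩
      suc (toℕ ((cyc ^ k) x)) % n       ≡⟨ cong (λ y → suc y % n) (toℕ-cyc^ k x) ⟩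
      (1 + (toℕ x + k) % n) % n         ≡⟨ %-distribˡ-+ 1 ((toℕ x + k) % n) n ⟩
      (1 % n + (toℕ x + k) % n % n) % n ≡⟨ cong (λ y → (1 % n + y) % n) (m%n%n≡m%n (toℕ x + k) n) ⟩
      (1 % n + (toℕ x + k) % n) % n     ≡⟨ %-distribˡ-+ 1 (toℕ x + k) n ⟨
      suc (toℕ x + k) % n               ≡⟨ cong (_% n) (+-suc (toℕ x) k) ⟨
      (toℕ x + suc k) % n               ∎
      where open ≡-Reasoning

    cyc^-period : ∀ (x : Fin n) → (cyc ^ n) x ≡ x
    cyc^-period x = toℕ-injective (begin
      toℕ ((cyc ^ n) x) ≡⟨ toℕ-cyc^ n x ⟩
      (toℕ x + n) % n   ≡⟨ [m+n]%n≡m%n (toℕ x) n ⟩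
      toℕ x % n         ≡⟨ m<n⇒m%n≡m (toℕ<n x) ⟩
      toℕ x             ∎)
      where open ≡-Reasoning

    cyc^-inverse : ∀ j k → j + k ≡ n → ∀ (x : Fin n) → (cyc ^ j) ((cyc ^ k) x) ≡ x
    cyc^-inverse j k j+k≡n x = begin
      (cyc ^ j) ((cyc ^ k) x) ≡⟨ ^-+ cyc j k x ⟨
      (cyc ^ (j + k)) x       ≡⟨ cong (λ i → (cyc ^ i) x) j+k≡n ⟩
      (cyc ^ n) x             ≡⟨ cyc^-period x ⟩
      x                       ∎
      where open ≡-Reasoning

    -- that is, cyc ∘ rev is an involution (a reflection of the n-gon)
    cyc-rev-cyc : ∀ (x : Fin n) → cyc (rev (cyc x)) ≡ rev x
    cyc-rev-cyc x with m≤n⇒m<n∨m≡n (s≤s⁻¹ (toℕ<n x))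
    ... | inj₁ x<m = toℕ-injective (begin
      toℕ (cyc (rev (cyc x))) ≡⟨ toℕ-cyc-< rev-cyc-x<m ⟩
      suc (toℕ (rev (cyc x))) ≡⟨ cong suc toℕ-rev-cyc-x ⟩
      suc (m ∸ suc (toℕ x))   ≡⟨ +-∸-assoc 1 x<m ⟨
      m ∸ toℕ x               ≡⟨ opposite-prop x ⟨
      toℕ (rev x)             ∎)
      where
      open ≡-Reasoning
      toℕ-rev-cyc-x : toℕ (rev (cyc x)) ≡ m ∸ suc (toℕ x)
      toℕ-rev-cyc-x = trans (opposite-prop (cyc x)) (cong (λ y → n ∸ suc y) (toℕ-cyc-< x<m))
      rev-cyc-x<m : toℕ (rev (cyc x)) < m
      rev-cyc-x<m = subst (_< m) (sym toℕ-rev-cyc-x) (∸-monoʳ-< (s≤s z≤n) x<m)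
    ... | inj₂ x≡m = toℕ-injective (begin
      toℕ (cyc (rev (cyc x))) ≡⟨ toℕ-cyc-last toℕ-rev-cyc-x ⟩
      0                       ≡⟨ n∸n≡0 m ⟨
      m ∸ m                   ≡⟨ cong (m ∸_) x≡m ⟨
      m ∸ toℕ x               ≡⟨ opposite-prop x ⟨
      toℕ (rev x)             ∎)
      where
      open ≡-Reasoning
      toℕ-rev-cyc-x : toℕ (rev (cyc x)) ≡ m
      toℕ-rev-cyc-x = trans (opposite-prop (cyc x)) (cong (λ y → n ∸ suc y) (toℕ-cyc-last x≡m))

    rev-cyc : ∀ (x : Fin n) → rev (cyc x) ≡ (cyc ^ m) (rev x)
    rev-cyc x = begin
      rev (cyc x)                   ≡⟨ cyc^-inverse m 1 (+-comm m 1) (rev (cyc x)) ⟨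
      (cyc ^ m) (cyc (rev (cyc x))) ≡⟨ cong (cyc ^ m) (cyc-rev-cyc x) ⟩
      (cyc ^ m) (rev x)             ∎
      where open ≡-Reasoning

    rev-cyc^ : ∀ k → ∃[ j ] (∀ (x : Fin n) → rev ((cyc ^ k) x) ≡ (cyc ^ j) (rev x))
    rev-cyc^ zero    = 0 , λ x → refl
    rev-cyc^ (suc k) with rev-cyc^ k
    ... | j , rev-cyc^k = m + j , λ x → begin
      rev (cyc ((cyc ^ k) x))       ≡⟨ rev-cyc _ ⟩
      (cyc ^ m) (rev ((cyc ^ k) x)) ≡⟨ cong (cyc ^ m) (rev-cyc^k x) ⟩
      (cyc ^ m) ((cyc ^ j) (rev x)) ≡⟨ ^-+ cyc m j (rev x) ⟨
      (cyc ^ (m + j)) (rev x)       ∎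
      where open ≡-Reasoning

    private
      cyclic-cyc-increasing : ∀ {x y z : Fin n} → toℕ x < toℕ y → toℕ y < toℕ z →
                              Cyclic (toℕ (cyc x)) (toℕ (cyc y)) (toℕ (cyc z))
      cyclic-cyc-increasing {x} {y} {z} x<y y<z with m≤n⇒m<n∨m≡n (s≤s⁻¹ (toℕ<n z))
      ... | inj₁ z<m
        rewrite toℕ-cyc-< (<-trans (<-trans x<y y<z) z<m) | toℕ-cyc-< (<-trans y<z z<m) | toℕ-cyc-< z<m
        = inj₁ (s≤s x<y , s≤s y<z)
      ... | inj₂ z≡m
        rewrite toℕ-cyc-< (<-≤-trans (<-trans x<y y<z) (≤-reflexive z≡m))
              | toℕ-cyc-< (<-≤-trans y<z (≤-reflexive z≡m)) | toℕ-cyc-last z≡m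
        = inj₂ (inj₂ (s≤s z≤n , s≤s x<y))

    cyclic-cyc : ∀ {x y z : Fin n} → Cyclic (toℕ x) (toℕ y) (toℕ z) →
                 Cyclic (toℕ (cyc x)) (toℕ (cyc y)) (toℕ (cyc z))
    cyclic-cyc (inj₁ (p , q))        = cyclic-cyc-increasing p q
    cyclic-cyc (inj₂ (inj₁ (p , q))) = cyclic-rotate (cyclic-rotate (cyclic-cyc-increasing p q))
    cyclic-cyc (inj₂ (inj₂ (p , q))) = cyclic-rotate (cyclic-cyc-increasing p q)

    cyclic-cyc^ : ∀ k {x y z : Fin n} → Cyclic (toℕ x) (toℕ y) (toℕ z) →
                  Cyclic (toℕ ((cyc ^ k) x)) (toℕ ((cyc ^ k) y)) (toℕ ((cyc ^ k) z))
    cyclic-cyc^ zero    xyz = xyz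
    cyclic-cyc^ (suc k) xyz = cyclic-cyc (cyclic-cyc^ k xyz)

    circular-cyc : ∀ {w x y z : Fin n} → Circular (toℕ w) (toℕ x) (toℕ y) (toℕ z) →
                   Circular (toℕ (cyc w)) (toℕ (cyc x)) (toℕ (cyc y)) (toℕ (cyc z))
    circular-cyc (inj₁ (p , q)) = inj₁ (cyclic-cyc p , cyclic-cyc q)
    circular-cyc (inj₂ (p , q)) = inj₂ (cyclic-cyc p , cyclic-cyc q)

  module _ {n : ℕ} where

    dihedral-cong : {σ τ : Fin n → Fin n} → (∀ i → σ i ≡ τ i) → InDihedral n σ → InDihedral n τ
    dihedral-cong σ≗τ (k , inj₁ σ≗) = k , inj₁ (λ i → trans (sym (σ≗τ i)) (σ≗ i))
    dihedral-cong σ≗τ (k , inj₂ σ≗) = k , inj₂ (λ i → trans (sym (σ≗τ i)) (σ≗ i))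

    dihedral-id : InDihedral n id
    dihedral-id = 0 , inj₁ (λ _ → refl)

    dihedral-cyc^ : ∀ k {σ : Fin n → Fin n} → InDihedral n σ → InDihedral n ((cyc ^ k) ∘ σ)
    dihedral-cyc^ k (j , inj₁ σ≗) =
      k + j , inj₁ (λ i → trans (cong (cyc ^ k) (σ≗ i)) (sym (^-+ cyc k j i)))
    dihedral-cyc^ k (j , inj₂ σ≗) =
      k + j , inj₂ (λ i → trans (cong (cyc ^ k) (σ≗ i)) (sym (^-+ cyc k j (rev i))))

  module _ {m : ℕ} {σ : Fin (suc m) → Fin (suc m)} where

    dihedral-rev : InDihedral (suc m) σ → InDihedral (suc m) (rev ∘ σ)
    dihedral-rev (k , inj₁ σ≗) with rev-cyc^ k
    ... | j , rev-cyc^k = j , inj₂ (λ i → trans (cong rev (σ≗ i)) (rev-cyc^k i))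
    dihedral-rev (k , inj₂ σ≗) with rev-cyc^ k
    ... | j , rev-cyc^k = j , inj₁ (λ i → begin
      rev (σ i)                   ≡⟨ cong rev (σ≗ i) ⟩
      rev ((cyc ^ k) (rev i))     ≡⟨ rev-cyc^k (rev i) ⟩
      (cyc ^ j) (rev (rev i))     ≡⟨ cong (cyc ^ j) (opposite-involutive i) ⟩
      (cyc ^ j) i                 ∎)
      where open ≡-Reasoning

    dihedral-cyc^⁻¹ : ∀ {k} → k ≤ suc m → InDihedral (suc m) ((cyc ^ k) ∘ σ) → InDihedral (suc m) σ
    dihedral-cyc^⁻¹ {k} k≤n σ∈D =
      dihedral-cong (cyc^-inverse (suc m ∸ k) k (m∸n+n≡m k≤n) ∘ σ) (dihedral-cyc^ (suc m ∸ k) σ∈D)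

  dihedral-rev⁻¹ : ∀ {m} {σ : Fin (suc m) → Fin (suc m)} →
                   InDihedral (suc m) (rev ∘ σ) → InDihedral (suc m) σ
  dihedral-rev⁻¹ {σ = σ} σ∈D = dihedral-cong (opposite-involutive ∘ σ) (dihedral-rev σ∈D)

  CircularPatterns : ∀ {n} → (Fin n → Fin n) → Set
  CircularPatterns σ = ∀ {i j k l} → i Fin.< j → j Fin.< k → k Fin.< l →
    Circular (toℕ (σ i)) (toℕ (σ j)) (toℕ (σ k)) (toℕ (σ l))

  module _ {n : ℕ} where

    circularPatterns-cong : {σ τ : Fin n → Fin n} → (∀ i → σ i ≡ τ i) →
                            CircularPatterns σ → CircularPatterns τ
    circularPatterns-cong σ≗τ σ-circ p q r =
      circular-map (λ {x} {y} → subst₂ (λ a b → toℕ a < toℕ b) (σ≗τ x) (σ≗τ y)) (σ-circ p q r)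

    circularPatterns-id : CircularPatterns {n} id
    circularPatterns-id p q r = inj₁ (inj₁ (p , q) , inj₁ (<-trans p q , r))

    circularPatterns-rev : {σ : Fin n → Fin n} → CircularPatterns σ → CircularPatterns (rev ∘ σ)
    circularPatterns-rev σ-circ p q r =
      circular-map-anti {u = toℕ} {v = toℕ ∘ rev} rev-anti (σ-circ p q r)

  circularPatterns-cyc^ : ∀ {m} k {σ : Fin (suc m) → Fin (suc m)} →
                          CircularPatterns σ → CircularPatterns ((cyc ^ k) ∘ σ)
  circularPatterns-cyc^ zero    σ-circ = σ-circ
  circularPatterns-cyc^ (suc k) σ-circ p q r = circular-cyc (circularPatterns-cyc^ k σ-circ p q r)

  dihedral⇒circularPatterns : ∀ {m} {σ : Fin (suc m) → Fin (suc m)} →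
                              InDihedral (suc m) σ → CircularPatterns σ
  dihedral⇒circularPatterns (k , inj₁ σ≗) =
    circularPatterns-cong (sym ∘ σ≗) (circularPatterns-cyc^ k circularPatterns-id)
  dihedral⇒circularPatterns (k , inj₂ σ≗) =
    circularPatterns-cong (sym ∘ σ≗) (circularPatterns-cyc^ k (circularPatterns-rev circularPatterns-id))

  module _ {m : ℕ} where

    private
      n : ℕ
      n = suc m

    toℕ-mod : ∀ {i} → i < n → toℕ (i mod n) ≡ i
    toℕ-mod i<n = trans (toℕ-fromℕ< _) (m<n⇒m%n≡m i<n)

    mod-toℕ : (i : Fin n) → toℕ i mod n ≡ i
    mod-toℕ i = toℕ-injective (toℕ-mod (toℕ<n i))

    -- positions are read as natural numbers, so that 1 + j, 2 + j, … need no Fin arithmetic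
    valueAt : (Fin n → Fin n) → ℕ → ℕ
    valueAt σ i = toℕ (σ (i mod n))

    circularPatterns-at : {σ : Fin n → Fin n} → CircularPatterns σ →
      ∀ {a b c d} → a < b → b < c → c < d → d < n →
      Circular (valueAt σ a) (valueAt σ b) (valueAt σ c) (valueAt σ d)
    circularPatterns-at σ-circ {c = c} a<b b<c c<d d<n =
      σ-circ (mod-< a<b (<-trans b<c c<n)) (mod-< b<c c<n) (mod-< c<d d<n)
      where
      c<n : c < n
      c<n = <-trans c<d d<n
      mod-< : ∀ {x y} → x < y → y < n → (x mod n) Fin.< (y mod n)
      mod-< x<y y<n = subst₂ _<_ (sym (toℕ-mod (<-trans x<y y<n))) (sym (toℕ-mod y<n)) x<y

    circularPatterns⇒id : {σ : Fin n → Fin n} → CircularPatterns σ → σ Fin.zero ≡ Fin.zero →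
      Cyclic (valueAt σ 0) (valueAt σ 1) (valueAt σ 2) → ∀ i → σ i ≡ i
    circularPatterns⇒id {σ} σ-circ σ0≡0 base i = toℕ-injective (begin
      toℕ (σ i)         ≡⟨ cong (toℕ ∘ σ) (mod-toℕ i) ⟨
      valueAt σ (toℕ i) ≡⟨ strictlyIncreasing⇒id (valueAt σ) increasing bounded (toℕ i) (toℕ<n i) ⟩
      toℕ i             ∎)
      where
      open ≡-Reasoning
      bounded : ∀ j → j < n → valueAt σ j < n
      bounded _ _ = toℕ<n _
      increasing : ∀ j → suc j < n → valueAt σ j < valueAt σ (suc j)
      increasing = circularFan⇒increasing (valueAt σ) (cong toℕ σ0≡0) base
        (λ j 3+j<n → circularPatterns-at σ-circ (s≤s z≤n) (n<1+n _) (n<1+n _) 3+j<n)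

    circularPatterns⇒dihedral⁺ : {σ : Fin n → Fin n} → CircularPatterns σ →
      Cyclic (valueAt σ 0) (valueAt σ 1) (valueAt σ 2) → InDihedral n σ
    circularPatterns⇒dihedral⁺ {σ} σ-circ base =
      dihedral-cyc^⁻¹ (m∸n≤m n (toℕ (σ Fin.zero)))
        (dihedral-cong (sym ∘ circularPatterns⇒id (circularPatterns-cyc^ k σ-circ) ρ0≡0 (cyclic-cyc^ k base))
                       dihedral-id)
      where
      k : ℕ
      k = n ∸ toℕ (σ Fin.zero)
      ρ0≡0 : (cyc ^ k) (σ Fin.zero) ≡ Fin.zero
      ρ0≡0 = toℕ-injective (begin
        toℕ ((cyc ^ k) (σ Fin.zero)) ≡⟨ toℕ-cyc^ k (σ Fin.zero) ⟩
        (toℕ (σ Fin.zero) + k) % n   ≡⟨ cong (_% n) (m+[n∸m]≡n (<⇒≤ (toℕ<n (σ Fin.zero)))) ⟩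
        n % n                        ≡⟨ n%n≡0 n ⟩
        0                            ∎)
        where open ≡-Reasoning

    circularPatterns⇒dihedral : {σ : Fin n → Fin n} → 3 < n → CircularPatterns σ → InDihedral n σ
    circularPatterns⇒dihedral 3<n σ-circ
      with circular-orientation (circularPatterns-at σ-circ (s≤s z≤n) (n<1+n 1) (n<1+n 2) 3<n)
    ... | inj₁ positive = circularPatterns⇒dihedral⁺ σ-circ positive
    ... | inj₂ negative = dihedral-rev⁻¹ (circularPatterns⇒dihedral⁺ (circularPatterns-rev σ-circ)
                            (cyclic-map-anti {u = toℕ} {v = toℕ ∘ rev} rev-anti negative))

  Circular₄ : ∀ {n} → (Fin 4 → Fin n) → Set
  Circular₄ f = Circular (toℕ (f Fin.zero)) (toℕ (f (Fin.suc Fin.zero)))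
                         (toℕ (f (Fin.suc (Fin.suc Fin.zero)))) (toℕ (f (Fin.suc (Fin.suc (Fin.suc Fin.zero)))))

  increasing<4 : ∀ {a b c d} → a < b → b < c → c < d → d < 4 → a ≡ 0 × b ≡ 1 × c ≡ 2 × d ≡ 3
  increasing<4 (s≤s z≤n) (s≤s (s≤s z≤n)) (s≤s (s≤s (s≤s z≤n))) (s≤s (s≤s (s≤s (s≤s z≤n)))) =
    refl , refl , refl , refl

  circular₄⇒circularPatterns : {σ : Fin 4 → Fin 4} → Circular₄ σ → CircularPatterns σ
  circular₄⇒circularPatterns circ {i} {j} {k} {l} i<j j<k k<l
    with increasing<4 i<j j<k k<l (toℕ<n l)
  ... | i≡0 , j≡1 , k≡2 , l≡3
    with toℕ-injective {i = i} i≡0 | toℕ-injective {i = j} j≡1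
       | toℕ-injective {i = k} k≡2 | toℕ-injective {i = l} l≡3
  ... | refl | refl | refl | refl = circ

  module _ {n : ℕ} (f : Fin 4 → Fin n) where

    rank-cong : ∀ {l j} → f l ≡ f j → rank f l ≡ rank f j
    rank-cong = cong (λ v → length (filter (λ x → f x <? v) (allFin 4)))

    rank-mono : ∀ {l j} → f l Fin.< f j → rank f l < rank f j
    rank-mono {l} {j} fl<fj =
      length-filter-< (λ x → f x <? f l) (λ x → f x <? f j) (λ fx<fl → <-trans fx<fl fl<fj)
        (Any.map (λ { refl → fl<fj , <-irrefl refl }) (∈-allFin l))

    rank-reflects : ∀ {l j} → rank f l < rank f j → f l Fin.< f j
    rank-reflects {l} {j} rl<rj with <-cmp (toℕ (f l)) (toℕ (f j))
    ... | tri< fl<fj _ _ = fl<fj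
    ... | tri≈ _ fl≡fj _ = contradiction rl<rj (<-irrefl (rank-cong (toℕ-injective fl≡fj)))
    ... | tri> _ _ fj<fl = contradiction rl<rj (<-asym (rank-mono fj<fl))

    rank<4 : ∀ j → rank f j < 4
    rank<4 j = filter-notAll (λ x → f x <? f j) (allFin 4)
                 (Any.map (λ { refl → <-irrefl refl }) (∈-allFin j))

    standardization : Fin 4 → Fin 4
    standardization j = fromℕ< (rank<4 j)

    stdInD4⇒circular₄ : StdInD4 f → Circular₄ f
    stdInD4⇒circular₄ (d , d∈D₄ , d≡rank) =
      circular-map {u = toℕ ∘ d}
        (λ {x} {y} dx<dy → rank-reflects (subst₂ _<_ (d≡rank x) (d≡rank y) dx<dy))
        (dihedral⇒circularPatterns d∈D₄ (s≤s z≤n) (s≤s (s≤s z≤n)) (s≤s (s≤s (s≤s z≤n))))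

    circular₄⇒stdInD4 : Circular₄ f → StdInD4 f
    circular₄⇒stdInD4 circ =
      standardization ,
      circularPatterns⇒dihedral ≤-refl (circular₄⇒circularPatterns (circular-map {u = toℕ ∘ f} mono circ)) ,
      λ j → toℕ-fromℕ< _
      where
      mono : ∀ {x y} → toℕ (f x) < toℕ (f y) → toℕ (standardization x) < toℕ (standardization y)
      mono fx<fy = subst₂ _<_ (sym (toℕ-fromℕ< _)) (sym (toℕ-fromℕ< _)) (rank-mono fx<fy)

open import Data.Fin using (_<_)

lemma5p3 : ∀ (n : ℕ) → 4 ≤ n → (τ : Permutation′ n) →
    InDihedral n (τ ⟨$⟩ʳ_) ⇔
    (∀ (i₁ i₂ i₃ i₄ : Fin n) → i₁ < i₂ → i₂ < i₃ → i₃ < i₄ →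
    StdInD4 (pattern4 τ i₁ i₂ i₃ i₄))
lemma5p3 (suc m) 3<n τ = mk⇔
  (λ τ∈Dₙ i₁ i₂ i₃ i₄ i₁<i₂ i₂<i₃ i₃<i₄ →
    circular₄⇒stdInD4 (pattern4 τ i₁ i₂ i₃ i₄)
      (dihedral⇒circularPatterns τ∈Dₙ i₁<i₂ i₂<i₃ i₃<i₄))
  (λ patterns∈D₄ → circularPatterns⇒dihedral 3<n λ {i₁} {i₂} {i₃} {i₄} i₁<i₂ i₂<i₃ i₃<i₄ →
    stdInD4⇒circular₄ (pattern4 τ i₁ i₂ i₃ i₄)
      (patterns∈D₄ i₁ i₂ i₃ i₄ i₁<i₂ i₂<i₃ i₃<i₄))
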